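{- Let $p\neq3$ be a prime and let $u_1,u_2,u_3,c$ be $p$-integral elements of $\mathbb{Q}_p$ such that the cubic $u_1X^3+u_2Y^3+u_3Z^3-cXYZ=0$ is $p$-reduced, $v_p(u_1u_2u_3)=0$, and $v_p(27u_1u_2u_3-c^3)>0$. Then the cubic has a nontrivial solution in $\mathbb{Q}_p$ if and only if the class of $u_2/u_1$ modulo $p$ is a cube in $\mathbb{F}_p^*$.
   Context: The cubic with $p$-integral coefficients is called $p$-reduced if $\min(v_p(u_1),v_p(u_2),v_p(u_3))=0$ and, if $p\mid c$, $v_p(u_1u_2u_3)\le2$. -}

module Defs where

open import Data.Nat using (ℕ; zero; suc; _+_; _*_; _^_; _<_)
open import Data.Product using (Σ; ∃; _×_; _,_)
open import Data.Sum using (_⊎_)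
open import Relation.Nullary using (¬_)
open import Relation.Binary.PropositionalEquality using (_≡_)

infix 4 _≡_[mod_]
_≡_[mod_] : ℕ → ℕ → ℕ → Set
a ≡ b [mod m ] = ∃ λ i → ∃ λ j → a + i * m ≡ b + j * m

-- The p-adic integers Z_p as the inverse limit of Z/p^k:
-- a coherent sequence of residues res k ∈ [0, p^k).
record ℤₚ (p : ℕ) : Set where
  constructor mkℤₚ
  field
    res     : ℕ → ℕ
    res-<   : ∀ k → res k < p ^ k
    res-coh : ∀ k → res (suc k) ≡ res k [mod p ^ k ]
open ℤₚ public

-- Q_p = Z_p[1/p]: an element is  num / p ^ exp.
record ℚₚ (p : ℕ) : Set where
  constructor _/p^_
  field
    num : ℤₚ p
    exp : ℕ
open ℚₚ public

NonzeroQₚ : ∀ {p} → ℚₚ p → Set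
NonzeroQₚ {p} x = ∃ λ k → ¬ (res (num x) k ≡ 0 [mod p ^ k ])

-- The equation u1 X^3 + u2 Y^3 + u3 Z^3 - c X Y Z = 0 at a point of Q_p^3,
-- with X = a/p^e, Y = b/p^f, Z = d/p^g, after multiplying by the unit
-- p^(3(e+f+g)); equality in Z_p is equality at every level Z/p^k.
CubicZero : ∀ {p} (u₁ u₂ u₃ c : ℤₚ p) (X Y Z : ℚₚ p) → Set
CubicZero {p} u₁ u₂ u₃ c X Y Z = ∀ k →
  let a = res (num X) k ; b = res (num Y) k ; d = res (num Z) k
      e = exp X ; f = exp Y ; g = exp Z
  in  res u₁ k * a ^ 3 * p ^ (3 * (f + g))
        + res u₂ k * b ^ 3 * p ^ (3 * (e + g))
        + res u₃ k * d ^ 3 * p ^ (3 * (e + f))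
      ≡ res c k * a * b * d * p ^ (2 * (e + f + g)) [mod p ^ k ]

HasNontrivialQₚPoint : ∀ {p} (u₁ u₂ u₃ c : ℤₚ p) → Set
HasNontrivialQₚPoint {p} u₁ u₂ u₃ c =
  Σ (ℚₚ p) λ X → Σ (ℚₚ p) λ Y → Σ (ℚₚ p) λ Z →
    (NonzeroQₚ X ⊎ NonzeroQₚ Y ⊎ NonzeroQₚ Z) × CubicZero u₁ u₂ u₃ c X Y Z

-- Valuation predicates on Z_p, read off from residues:
-- v_p(x) ≥ k  iff  x ≡ 0 mod p^k.
vₚ≥ : ∀ {p} → ℤₚ p → ℕ → Set
vₚ≥ {p} x k = res x k ≡ 0 [mod p ^ k ]

vₚprod≥ : ∀ {p} → ℤₚ p → ℤₚ p → ℤₚ p → ℕ → Set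
vₚprod≥ {p} u₁ u₂ u₃ k = res u₁ k * res u₂ k * res u₃ k ≡ 0 [mod p ^ k ]

-- p-reduced: min(v(u1),v(u2),v(u3)) = 0 and (p | c ⇒ v(u1 u2 u3) ≤ 2).
pReduced : ∀ {p} (u₁ u₂ u₃ c : ℤₚ p) → Set
pReduced u₁ u₂ u₃ c =
  (¬ vₚ≥ u₁ 1 ⊎ ¬ vₚ≥ u₂ 1 ⊎ ¬ vₚ≥ u₃ 1)
  × (vₚ≥ c 1 → ¬ vₚprod≥ u₁ u₂ u₃ 3)

vₚdisc>0 : ∀ {p} (u₁ u₂ u₃ c : ℤₚ p) → Set
vₚdisc>0 {p} u₁ u₂ u₃ c =
  27 * (res u₁ 1 * res u₂ 1 * res u₃ 1) ≡ res c 1 ^ 3 [mod p ^ 1 ]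

-- The class of u2/u1 mod p (u1 a unit) is a cube in F_p^*:
-- some t with t^3 ≡ u2/u1, i.e. t^3 * u1 ≡ u2 (mod p), t ≢ 0 (mod p).
ratioIsCubeModp : ∀ {p} (u₂ u₁ : ℤₚ p) → Set
ratioIsCubeModp {p} u₂ u₁ =
  ∃ λ t → ¬ (t ≡ 0 [mod p ]) × (t ^ 3 * res u₁ 1 ≡ res u₂ 1 [mod p ])

module Submission where

-- Modulo p the curve is the singular cubic u₁x³ + u₂y³ + u₃z³ = cxyz with c³ ≡ 27u₁u₂u₃.
-- (⇒) Clearing the denominators of a ℚₚ-point and dividing out common powers of p (descent)
--     gives a primitive zero modulo p.  There, A = u₁x³, B = u₂y³, C = u₃z³ satisfy
--     (A + B + C)³ ≡ 27ABC, and a case analysis (x, y units; y ≡ 0; x ≡ 0) based on the identity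
--     (s − 3B)³A − (s − 3A)³B = (A − B)(s³ − 27ABC), s = A + B + C, shows u₂/u₁ is a cube.
-- (⇐) If u₂/u₁ ≡ t³ then y₀ = −1/t is a simple zero of u₂y³ + u₁ modulo p (as p ≠ 3); Hensel
--     lifting produces a p-adic Y with u₂Y³ + u₁ = 0, and (1 : Y : 0) lies on the cubic.

open import Defs
open import Data.Nat using (ℕ; zero; suc; z≤n; s≤s)
import Data.Nat as Nat
import Data.Nat.Properties as ℕP
import Data.Nat.Divisibility as ℕ∣
import Data.Nat.Tactic.RingSolver as ℕSolver
open import Data.Nat.Primality
  using (Prime; euclidsLemma; prime⇒irreducible; prime⇒nonZero; prime⇒nonTrivial; ¬prime[1]; prime?)
open import Data.Nat.Coprimality using (Coprime; coprime-Bézout)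
import Data.Nat.GCD as GCD
open import Data.Integer using (ℤ; +_; -[1+_]; _+_; _*_; -_; _-_)
import Data.Integer as Int
import Data.Integer.Properties as ℤP
import Data.Integer.DivMod as ℤD
open import Data.Integer.Divisibility.Signed
  using (_∣_; divides; _∣?_; ∣-refl; ∣-trans; ∣m⇒∣m*n; ∣n⇒∣m*n; ∣m∣n⇒∣m+n; ∣m⇒∣-m;
         *-monoˡ-∣; *-cancelˡ-∣; *-cancelʳ-∣; ∣⇒∣ᵤ; ∣ᵤ⇒∣)
open import Data.Integer.Tactic.RingSolver using (solve-∀)
open import Data.Product using (Σ; _×_; _,_; proj₁; proj₂)
open import Data.Sum using (_⊎_; inj₁; inj₂)
open import Data.Empty using (⊥-elim)
open import Function.Bundles using (_⇔_; mk⇔)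
open import Relation.Nullary using (¬_; yes; no)
open import Relation.Nullary.Decidable using (from-yes; _×-dec_)
open import Relation.Binary.PropositionalEquality
  using (_≡_; _≢_; refl; sym; trans; cong; cong₂; subst; subst₂; module ≡-Reasoning)

-- Integer congruence modulo m: m divides the difference.  (A record rather than a
-- definition, so that a, b and m can be inferred from a congruence.)
infix 4 _≡_⟨mod_⟩
record _≡_⟨mod_⟩ (a b m : ℤ) : Set where
  constructor congruent
  field difference : m ∣ a - b
open _≡_⟨mod_⟩ public

-- Divisibility is preserved under ℤ-linear combinations.  Each use supplies the
-- combination as a ring identity, discharged by the ring solver.
∣-by₁ : ∀ {m a h} k → a ≡ k * h → m ∣ h → m ∣ a
∣-by₁ k a≡kh m∣h = subst (_ ∣_) (sym a≡kh) (∣n⇒∣m*n k m∣h)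

∣-by₂ : ∀ {m a h₁ h₂} k₁ k₂ → a ≡ k₁ * h₁ + k₂ * h₂ → m ∣ h₁ → m ∣ h₂ → m ∣ a
∣-by₂ k₁ k₂ eq d₁ d₂ =
  subst (_ ∣_) (sym eq) (∣m∣n⇒∣m+n (∣n⇒∣m*n k₁ d₁) (∣n⇒∣m*n k₂ d₂))

∣-by₃ : ∀ {m a h₁ h₂ h₃} k₁ k₂ k₃ → a ≡ k₁ * h₁ + k₂ * h₂ + k₃ * h₃ →
        m ∣ h₁ → m ∣ h₂ → m ∣ h₃ → m ∣ a
∣-by₃ k₁ k₂ k₃ eq d₁ d₂ d₃ =
  subst (_ ∣_) (sym eq) (∣m∣n⇒∣m+n (∣m∣n⇒∣m+n (∣n⇒∣m*n k₁ d₁) (∣n⇒∣m*n k₂ d₂)) (∣n⇒∣m*n k₃ d₃))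

∣-zero : ∀ {m} → m ∣ + 0
∣-zero {m} = divides (+ 0) (sym (ℤP.*-zeroˡ m))

1∣_ : ∀ a → + 1 ∣ a
1∣ a = divides a (sym (ℤP.*-identityʳ a))

mod-refl : ∀ {m a} → a ≡ a ⟨mod m ⟩
mod-refl {a = a} = congruent (subst (_ ∣_) (sym (ℤP.+-inverseʳ a)) ∣-zero)

mod-sym : ∀ {m a b} → a ≡ b ⟨mod m ⟩ → b ≡ a ⟨mod m ⟩
mod-sym {a = a} {b} (congruent d) = congruent (∣-by₁ (- + 1) (identity a b) d)
  where identity : ∀ a b → b - a ≡ (- + 1) * (a - b)
        identity = solve-∀

mod-trans : ∀ {m a b c} → a ≡ b ⟨mod m ⟩ → b ≡ c ⟨mod m ⟩ → a ≡ c ⟨mod m ⟩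
mod-trans {a = a} {b} {c} (congruent d₁) (congruent d₂) = congruent (∣-by₂ (+ 1) (+ 1) (identity a b c) d₁ d₂)
  where identity : ∀ a b c → a - c ≡ + 1 * (a - b) + + 1 * (b - c)
        identity = solve-∀

mod-weaken : ∀ {m n a b} → n ∣ m → a ≡ b ⟨mod m ⟩ → a ≡ b ⟨mod n ⟩
mod-weaken n∣m (congruent d) = congruent (∣-trans n∣m d)

∣-resp-mod : ∀ {m a b} → a ≡ b ⟨mod m ⟩ → m ∣ b → m ∣ a
∣-resp-mod {a = a} {b} (congruent d) = ∣-by₂ (+ 1) (+ 1) (identity a b) d
  where identity : ∀ a b → a ≡ + 1 * (a - b) + + 1 * b
        identity = solve-∀

∣⇒≡0 : ∀ {m a} → m ∣ a → a ≡ + 0 ⟨mod m ⟩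
∣⇒≡0 {a = a} m∣a = congruent (subst (_ ∣_) (sym (ℤP.+-identityʳ a)) m∣a)

≡0⇒∣ : ∀ {m a} → a ≡ + 0 ⟨mod m ⟩ → m ∣ a
≡0⇒∣ {a = a} (congruent d) = subst (_ ∣_) (ℤP.+-identityʳ a) d

mod-*ʳ : ∀ {m a b} k → a ≡ b ⟨mod m ⟩ → a * k ≡ b * k ⟨mod m ⟩
mod-*ʳ {a = a} {b} k (congruent d) = congruent (∣-by₁ k (identity a b k) d)
  where identity : ∀ a b k → a * k - b * k ≡ k * (a - b)
        identity = solve-∀

mod-cast : ∀ {m m′ a a′ b b′} → a ≡ a′ → b ≡ b′ → m ≡ m′ → a ≡ b ⟨mod m ⟩ → a′ ≡ b′ ⟨mod m′ ⟩
mod-cast refl refl refl h = h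

cube-mod : ∀ {m a b} → a ≡ b ⟨mod m ⟩ → a * a * a ≡ b * b * b ⟨mod m ⟩
cube-mod {a = a} {b} (congruent d) = congruent (∣-by₁ (a * a + a * b + b * b) (identity a b) d)
  where identity : ∀ a b → a * a * a - b * b * b ≡ (a * a + a * b + b * b) * (a - b)
        identity = solve-∀

reduce : ∀ m .{{_ : Nat.NonZero m}} (y : ℤ) → Σ ℕ λ r → r Nat.< m × + r ≡ y ⟨mod + m ⟩
reduce m y = y ℤD.%ℕ m , ℤD.n%ℕd<d y m , congruent (
  ∣-by₁ (- (y ℤD./ℕ m)) (remainder (+ (y ℤD.%ℕ m)) (y ℤD./ℕ m) (ℤD.a≡a%ℕn+[a/ℕn]*n y m)) ∣-refl)
  where
  remainder : ∀ r q → y ≡ r + q * + m → r - y ≡ (- q) * + m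
  remainder r q refl = identity r q (+ m)
    where identity : ∀ r q m → r - (r + q * m) ≡ (- q) * m
          identity = solve-∀

pos-affine : ∀ a i m → + (a Nat.+ i Nat.* m) ≡ + a + + i * + m
pos-affine a i m = trans (ℤP.pos-+ a (i Nat.* m)) (cong (_+_ (+ a)) (ℤP.pos-* i m))

pos-*₃ : ∀ a b c → + (a Nat.* b Nat.* c) ≡ + a * + b * + c
pos-*₃ a b c = trans (ℤP.pos-* (a Nat.* b) c) (cong (_* + c) (ℤP.pos-* a b))

pos-cube : ∀ a → + (a Nat.^ 3) ≡ + a * + a * + a
pos-cube a = trans (cong +_ (cube a)) (pos-*₃ a a a)
  where cube : ∀ a → a Nat.^ 3 ≡ a Nat.* a Nat.* a
        cube a = trans (cong (λ t → a Nat.* (a Nat.* t)) (ℕP.*-identityʳ a)) (sym (ℕP.*-assoc a a a))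

affine⇒diff : ∀ A B I J M → A + I * M ≡ B + J * M → A - B ≡ (J - I) * M
affine⇒diff A B I J M e = begin
    A - B                                 ≡⟨ identity A B I J M ⟩
    (A + I * M) - (B + J * M) + (J - I) * M ≡⟨ cong (λ t → t - (B + J * M) + (J - I) * M) e ⟩
    (B + J * M) - (B + J * M) + (J - I) * M ≡⟨ cancel (B + J * M) ((J - I) * M) ⟩
    (J - I) * M                           ∎
  where
  open ≡-Reasoning
  identity : ∀ A B I J M → A - B ≡ (A + I * M) - (B + J * M) + (J - I) * M
  identity = solve-∀
  cancel : ∀ s t → s - s + t ≡ t
  cancel = solve-∀

diff⇒affine : ∀ A B I J M → A - B ≡ (J - I) * M → A + I * M ≡ B + J * M
diff⇒affine A B I J M e = begin
    A + I * M           ≡⟨ identity₁ A B I M ⟩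
    (A - B) + B + I * M ≡⟨ cong (λ t → t + B + I * M) e ⟩
    (J - I) * M + B + I * M ≡⟨ identity₂ B I J M ⟩
    B + J * M           ∎
  where
  open ≡-Reasoning
  identity₁ : ∀ A B I M → A + I * M ≡ (A - B) + B + I * M
  identity₁ = solve-∀
  identity₂ : ∀ B I J M → (J - I) * M + B + I * M ≡ B + J * M
  identity₂ = solve-∀

mod⇒∣ : ∀ {a b m} → a ≡ b [mod m ] → + a ≡ + b ⟨mod + m ⟩
mod⇒∣ {a} {b} {m} (i , j , e) = congruent (
  divides (+ j - + i) (affine⇒diff (+ a) (+ b) (+ i) (+ j) (+ m) (trans (sym (pos-affine a i m)) (trans (cong +_ e) (pos-affine b j m)))))

asDifference : ∀ q → Σ ℕ λ i → Σ ℕ λ j → + j - + i ≡ q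
asDifference (+ n)     = 0 , n , ℤP.+-identityʳ (+ n)
asDifference -[1+ n ] = suc n , 0 , refl

∣⇒mod : ∀ {a b m} → + a ≡ + b ⟨mod + m ⟩ → a ≡ b [mod m ]
∣⇒mod {a} {b} {m} (congruent (divides q eq)) with asDifference q
... | i , j , j-i≡q = i , j , ℤP.+-injective (begin
    + (a Nat.+ i Nat.* m) ≡⟨ pos-affine a i m ⟩
    + a + + i * + m       ≡⟨ diff⇒affine (+ a) (+ b) (+ i) (+ j) (+ m) (trans eq (cong (_* + m) (sym j-i≡q))) ⟩
    + b + + j * + m       ≡⟨ pos-affine b j m ⟨
    + (b Nat.+ j Nat.* m) ∎)
  where
  open ≡-Reasoning

-- The cubic form u₁x³ + u₂y³ + u₃z³ − cxyz over ℤ.  The ring solver does not unfold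
-- definitions, so identities involving it are proved with the form written out.
cubic : (U₁ U₂ U₃ C x y z : ℤ) → ℤ
cubic U₁ U₂ U₃ C x y z = U₁ * (x * x * x) + U₂ * (y * y * y) + U₃ * (z * z * z) - C * x * y * z

cubic-rotate : ∀ U₁ U₂ U₃ C x y z → cubic U₁ U₂ U₃ C x y z ≡ cubic U₂ U₃ U₁ C y z x
cubic-rotate = identity
  where identity : ∀ U₁ U₂ U₃ C x y z →
          U₁ * (x * x * x) + U₂ * (y * y * y) + U₃ * (z * z * z) - C * x * y * z
            ≡ U₂ * (y * y * y) + U₃ * (z * z * z) + U₁ * (x * x * x) - C * y * z * x
        identity = solve-∀

cubic-coefficients : ∀ {m} U₁ U₂ U₃ C U₁′ U₂′ U₃′ C′ x y z →
  U₁ ≡ U₁′ ⟨mod m ⟩ → U₂ ≡ U₂′ ⟨mod m ⟩ → U₃ ≡ U₃′ ⟨mod m ⟩ → C ≡ C′ ⟨mod m ⟩ →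
  cubic U₁ U₂ U₃ C x y z ≡ cubic U₁′ U₂′ U₃′ C′ x y z ⟨mod m ⟩
cubic-coefficients U₁ U₂ U₃ C U₁′ U₂′ U₃′ C′ x y z
                   (congruent d₁) (congruent d₂) (congruent d₃) (congruent d₄) =
  congruent (∣-by₂ (+ 1) (+ 1) (identity U₁ U₂ U₃ C U₁′ U₂′ U₃′ C′ x y z)
    (∣-by₂ (x * x * x) (y * y * y) refl d₁ d₂) (∣-by₂ (z * z * z) (- (x * y * z)) refl d₃ d₄))
  where identity : ∀ U₁ U₂ U₃ C U₁′ U₂′ U₃′ C′ x y z →
          (U₁ * (x * x * x) + U₂ * (y * y * y) + U₃ * (z * z * z) - C * x * y * z)
            - (U₁′ * (x * x * x) + U₂′ * (y * y * y) + U₃′ * (z * z * z) - C′ * x * y * z)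
          ≡ + 1 * ((x * x * x) * (U₁ - U₁′) + (y * y * y) * (U₂ - U₂′))
            + + 1 * ((z * z * z) * (U₃ - U₃′) + (- (x * y * z)) * (C - C′))
        identity = solve-∀

cubic-homogeneous : ∀ U₁ U₂ U₃ C x y z k →
  cubic U₁ U₂ U₃ C (x * k) (y * k) (z * k) ≡ k * (k * (k * cubic U₁ U₂ U₃ C x y z))
cubic-homogeneous = identity
  where identity : ∀ U₁ U₂ U₃ C x y z k →
          U₁ * (x * k * (x * k) * (x * k)) + U₂ * (y * k * (y * k) * (y * k)) + U₃ * (z * k * (z * k) * (z * k))
            - C * (x * k) * (y * k) * (z * k)
          ≡ k * (k * (k * (U₁ * (x * x * x) + U₂ * (y * y * y) + U₃ * (z * z * z) - C * x * y * z)))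
        identity = solve-∀

cubic-at-1y0 : ∀ U₁ U₂ U₃ C y → cubic U₁ U₂ U₃ C (+ 1) y (+ 0) ≡ U₂ * (y * y * y) + U₁
cubic-at-1y0 = identity
  where identity : ∀ U₁ U₂ U₃ C y →
          U₁ * (+ 1 * + 1 * + 1) + U₂ * (y * y * y) + U₃ * (+ 0 * + 0 * + 0) - C * + 1 * y * + 0 ≡ U₂ * (y * y * y) + U₁
        identity = solve-∀

-- The residue presentation of ℤₚ and ℚₚ from Defs, read as divisibility by powers of p in ℤ.
module Powers (p : ℕ) .{{_ : Nat.NonZero p}} where

  p^ : ℕ → ℤ
  p^ k = + (p Nat.^ k)

  p^-suc : ∀ k → p^ (suc k) ≡ + p * p^ k
  p^-suc k = ℤP.pos-* p (p Nat.^ k)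

  p^-+ : ∀ j k → p^ (j Nat.+ k) ≡ p^ j * p^ k
  p^-+ j k = trans (cong +_ (ℕP.^-distribˡ-+-* p j k)) (ℤP.pos-* (p Nat.^ j) (p Nat.^ k))

  p^-1 : p^ 1 ≡ + p
  p^-1 = cong +_ (ℕP.*-identityʳ p)

  p^-∣ : ∀ {j K} → j Nat.≤ K → p^ j ∣ p^ K
  p^-∣ {j} {K} j≤K =
    divides (p^ (K Nat.∸ j)) (trans (cong p^ (sym (ℕP.m∸n+n≡m j≤K))) (p^-+ (K Nat.∸ j) j))

  res-mod : ∀ (x : ℤₚ p) {j K} → j Nat.≤ K → + res x K ≡ + res x j ⟨mod p^ j ⟩
  res-mod x {j} {K} j≤K = subst (λ L → + res x L ≡ + res x j ⟨mod p^ j ⟩) (ℕP.m∸n+n≡m j≤K) (above (K Nat.∸ j))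
    where
    above : ∀ d → + res x (d Nat.+ j) ≡ + res x j ⟨mod p^ j ⟩
    above zero    = mod-refl
    above (suc d) = mod-trans (mod-weaken (p^-∣ (ℕP.m≤n+m j d)) (mod⇒∣ (res-coh x (d Nat.+ j)))) (above d)

  level-one : ∀ (w : ℤₚ p) {K} → 1 Nat.≤ K → + res w K ≡ + res w 1 ⟨mod + p ⟩
  level-one w 1≤K = mod-cast refl refl p^-1 (res-mod w 1≤K)

  fromCoherent : (y : ℕ → ℤ) → (∀ k → y (suc k) ≡ y k ⟨mod p^ k ⟩) → ℤₚ p
  fromCoherent y coh = mkℤₚ (λ k → proj₁ (residue k)) (λ k → proj₁ (proj₂ (residue k))) coherent
    where
    residue : ∀ k → Σ ℕ λ r → r Nat.< p Nat.^ k × + r ≡ y k ⟨mod p^ k ⟩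
    residue k = reduce (p Nat.^ k) {{ℕP.m^n≢0 p k}} (y k)
    coherent : ∀ k → proj₁ (residue (suc k)) ≡ proj₁ (residue k) [mod p Nat.^ k ]
    coherent k = ∣⇒mod (mod-trans (mod-weaken (p^-∣ (ℕP.n≤1+n k)) (proj₂ (proj₂ (residue (suc k)))))
                                  (mod-trans (coh k) (mod-sym (proj₂ (proj₂ (residue k))))))

  fromCoherent-res : ∀ y coh k → + res (fromCoherent y coh) k ≡ y k ⟨mod p^ k ⟩
  fromCoherent-res y coh k = proj₂ (proj₂ (reduce (p Nat.^ k) {{ℕP.m^n≢0 p k}} (y k)))

  -- Clearing the denominators of a point of ℚₚ³: the exponent bookkeeping.
  p^-sum₃ : ∀ i j k → p^ (i Nat.+ j Nat.+ k) ≡ p^ i * p^ j * p^ k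
  p^-sum₃ i j k = trans (p^-+ (i Nat.+ j) k) (cong (_* p^ k) (p^-+ i j))

  cast-cubeTerm : ∀ r a s →
    + (r Nat.* a Nat.^ 3 Nat.* p Nat.^ (3 Nat.* s)) ≡ + r * ((+ a * p^ s) * (+ a * p^ s) * (+ a * p^ s))
  cast-cubeTerm r a s = begin
    + (r Nat.* a Nat.^ 3 Nat.* p Nat.^ (3 Nat.* s))  ≡⟨ pos-*₃ r (a Nat.^ 3) (p Nat.^ (3 Nat.* s)) ⟩
    + r * + (a Nat.^ 3) * p^ (3 Nat.* s)              ≡⟨ cong₂ (λ u v → + r * u * v) (pos-cube a) p^-3s ⟩
    + r * (+ a * + a * + a) * (p^ s * p^ s * p^ s)    ≡⟨ identity (+ r) (+ a) (p^ s) ⟩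
    + r * ((+ a * p^ s) * (+ a * p^ s) * (+ a * p^ s)) ∎
    where
    open ≡-Reasoning
    p^-3s : p^ (3 Nat.* s) ≡ p^ s * p^ s * p^ s
    p^-3s = trans (cong p^ (thrice s)) (p^-sum₃ s s s)
      where thrice : ∀ s → 3 Nat.* s ≡ s Nat.+ s Nat.+ s
            thrice = ℕSolver.solve-∀
    identity : ∀ r a P → r * (a * a * a) * (P * P * P) ≡ r * ((a * P) * (a * P) * (a * P))
    identity = solve-∀

  cast-productTerm : ∀ r a b d e f g →
    + (r Nat.* a Nat.* b Nat.* d Nat.* p Nat.^ (2 Nat.* (e Nat.+ f Nat.+ g)))
      ≡ + r * (+ a * p^ (f Nat.+ g)) * (+ b * p^ (e Nat.+ g)) * (+ d * p^ (e Nat.+ f))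
  cast-productTerm r a b d e f g = begin
    + (r Nat.* a Nat.* b Nat.* d Nat.* p Nat.^ (2 Nat.* (e Nat.+ f Nat.+ g)))
      ≡⟨ ℤP.pos-* (r Nat.* a Nat.* b Nat.* d) (p Nat.^ (2 Nat.* (e Nat.+ f Nat.+ g))) ⟩
    + (r Nat.* a Nat.* b Nat.* d) * p^ (2 Nat.* (e Nat.+ f Nat.+ g))
      ≡⟨ cong₂ _*_ (trans (ℤP.pos-* (r Nat.* a Nat.* b) d) (cong (_* + d) (pos-*₃ r a b))) p^-2s ⟩
    + r * + a * + b * + d * (p^ (f Nat.+ g) * p^ (e Nat.+ g) * p^ (e Nat.+ f))
      ≡⟨ identity (+ r) (+ a) (+ b) (+ d) (p^ (f Nat.+ g)) (p^ (e Nat.+ g)) (p^ (e Nat.+ f)) ⟩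
    + r * (+ a * p^ (f Nat.+ g)) * (+ b * p^ (e Nat.+ g)) * (+ d * p^ (e Nat.+ f)) ∎
    where
    open ≡-Reasoning
    p^-2s : p^ (2 Nat.* (e Nat.+ f Nat.+ g)) ≡ p^ (f Nat.+ g) * p^ (e Nat.+ g) * p^ (e Nat.+ f)
    p^-2s = trans (cong p^ (regroup e f g)) (p^-sum₃ (f Nat.+ g) (e Nat.+ g) (e Nat.+ f))
      where regroup : ∀ e f g → 2 Nat.* (e Nat.+ f Nat.+ g) ≡ (f Nat.+ g) Nat.+ (e Nat.+ g) Nat.+ (e Nat.+ f)
            regroup = ℕSolver.solve-∀
    identity : ∀ r a b d P Q R → r * a * b * d * (P * Q * R) ≡ r * (a * P) * (b * Q) * (d * R)
    identity = solve-∀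

  -- CubicZero at level k, read in ℤ: the cubic form with coefficients the level-k residues,
  -- at the coordinates brought to the common denominator p^(e+f+g).
  levelCubic : (u₁ u₂ u₃ c : ℤₚ p) (X Y Z : ℚₚ p) → ℕ → ℤ
  levelCubic u₁ u₂ u₃ c X Y Z k =
    cubic (+ res u₁ k) (+ res u₂ k) (+ res u₃ k) (+ res c k)
          (+ res (num X) k * p^ (exp Y Nat.+ exp Z))
          (+ res (num Y) k * p^ (exp X Nat.+ exp Z))
          (+ res (num Z) k * p^ (exp X Nat.+ exp Y))

  private
    cast-level : ∀ u₁ u₂ u₃ c X Y Z k →
      let a = res (num X) k ; b = res (num Y) k ; d = res (num Z) k
          e = exp X ; f = exp Y ; g = exp Z
      in  + (res u₁ k Nat.* a Nat.^ 3 Nat.* p Nat.^ (3 Nat.* (f Nat.+ g))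
               Nat.+ res u₂ k Nat.* b Nat.^ 3 Nat.* p Nat.^ (3 Nat.* (e Nat.+ g))
               Nat.+ res u₃ k Nat.* d Nat.^ 3 Nat.* p Nat.^ (3 Nat.* (e Nat.+ f)))
          - + (res c k Nat.* a Nat.* b Nat.* d Nat.* p Nat.^ (2 Nat.* (e Nat.+ f Nat.+ g)))
          ≡ levelCubic u₁ u₂ u₃ c X Y Z k
    cast-level u₁ u₂ u₃ c X Y Z k =
      cong₂ _-_
        (trans (ℤP.pos-+ (t₁ Nat.+ t₂) t₃)
          (cong₂ _+_ (trans (ℤP.pos-+ t₁ t₂)
                            (cong₂ _+_ (cast-cubeTerm (res u₁ k) a (f Nat.+ g)) (cast-cubeTerm (res u₂ k) b (e Nat.+ g))))
                     (cast-cubeTerm (res u₃ k) d (e Nat.+ f))))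
        (cast-productTerm (res c k) a b d e f g)
      where
      a = res (num X) k ; b = res (num Y) k ; d = res (num Z) k
      e = exp X ; f = exp Y ; g = exp Z
      t₁ = res u₁ k Nat.* a Nat.^ 3 Nat.* p Nat.^ (3 Nat.* (f Nat.+ g))
      t₂ = res u₂ k Nat.* b Nat.^ 3 Nat.* p Nat.^ (3 Nat.* (e Nat.+ g))
      t₃ = res u₃ k Nat.* d Nat.^ 3 Nat.* p Nat.^ (3 Nat.* (e Nat.+ f))

  cubicZero⇒level : ∀ u₁ u₂ u₃ c X Y Z → CubicZero u₁ u₂ u₃ c X Y Z →
                    ∀ k → p^ k ∣ levelCubic u₁ u₂ u₃ c X Y Z k
  cubicZero⇒level u₁ u₂ u₃ c X Y Z onCubic k =
    subst (p^ k ∣_) (cast-level u₁ u₂ u₃ c X Y Z k) (difference (mod⇒∣ (onCubic k)))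

  level⇒cubicZero : ∀ u₁ u₂ u₃ c X Y Z → (∀ k → p^ k ∣ levelCubic u₁ u₂ u₃ c X Y Z k) →
                    CubicZero u₁ u₂ u₃ c X Y Z
  level⇒cubicZero u₁ u₂ u₃ c X Y Z level k =
    ∣⇒mod (congruent (subst (p^ k ∣_) (sym (cast-level u₁ u₂ u₃ c X Y Z k)) (level k)))

  nonzero-persists : ∀ (w : ℤₚ p) {k₀ K} s → ¬ (res w k₀ ≡ 0 [mod p Nat.^ k₀ ]) → k₀ Nat.≤ K →
                     ¬ p^ (k₀ Nat.+ s) ∣ + res w K * p^ s
  nonzero-persists w {k₀} {K} s nonzero k₀≤K divisible =
    nonzero (∣⇒mod (∣⇒≡0 atLevel₀))
    where
    atLevelK : p^ k₀ ∣ + res w K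
    atLevelK = *-cancelʳ-∣ (p^ s) {{ℕP.m^n≢0 p s}} (subst (_∣ _) (p^-+ k₀ s) divisible)
    atLevel₀ : p^ k₀ ∣ + res w k₀
    atLevel₀ = ∣-resp-mod (mod-sym (res-mod w k₀≤K)) atLevelK

-- Arithmetic modulo a prime p.
module ModPrime (p : ℕ) (p-prime : Prime p) where

  instance
    p≢0 : Nat.NonZero p
    p≢0 = prime⇒nonZero p-prime

  open Powers p public

  Unit : ℤ → Set
  Unit a = ¬ (+ p ∣ a)

  euclid : ∀ {a b} → + p ∣ a * b → + p ∣ a ⊎ + p ∣ b
  euclid {a} {b} p∣ab with euclidsLemma Int.∣ a ∣ Int.∣ b ∣ p-prime (subst (p ℕ∣.∣_) (ℤP.abs-* a b) (∣⇒∣ᵤ p∣ab))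
  ... | inj₁ p∣a = inj₁ (∣ᵤ⇒∣ p∣a)
  ... | inj₂ p∣b = inj₂ (∣ᵤ⇒∣ p∣b)

  unit-* : ∀ {a b} → Unit a → Unit b → Unit (a * b)
  unit-* unit-a unit-b p∣ab with euclid p∣ab
  ... | inj₁ p∣a = unit-a p∣a
  ... | inj₂ p∣b = unit-b p∣b

  unit-cube : ∀ {a} → Unit a → Unit (a * a * a)
  unit-cube unit-a = unit-* (unit-* unit-a unit-a) unit-a

  unit-neg : ∀ {a} → Unit a → Unit (- a)
  unit-neg {a} unit-a p∣-a = unit-a (subst (+ p ∣_) (ℤP.neg-involutive a) (∣m⇒∣-m p∣-a))

  unit-one : Unit (+ 1)
  unit-one p∣1 = ¬prime[1] (subst Prime (ℕ∣.∣1⇒≡1 (∣⇒∣ᵤ p∣1)) p-prime)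

  unit-cube-∣ : ∀ {k a} → Unit k → + p ∣ k * (a * a * a) → + p ∣ a
  unit-cube-∣ {a = a} unit-k p∣ka³ with + p ∣? a
  ... | yes p∣a = p∣a
  ... | no  unit-a = ⊥-elim (unit-* unit-k (unit-cube unit-a) p∣ka³)

  unit-square-∣ : ∀ {k a} → Unit k → + p ∣ k * (a * a) → + p ∣ a
  unit-square-∣ {a = a} unit-k p∣ka² with + p ∣? a
  ... | yes p∣a = p∣a
  ... | no  unit-a = ⊥-elim (unit-* unit-k (unit-* unit-a unit-a) p∣ka²)

  private
    coprime : ∀ {n} → Unit (+ n) → Coprime p n
    coprime unit-n {d} (d∣p , d∣n) with prime⇒irreducible p-prime d∣p
    ... | inj₁ d≡1  = d≡1
    ... | inj₂ refl = ⊥-elim (unit-n (∣ᵤ⇒∣ d∣n))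

    cast-Bézout : ∀ a b c d e → a Nat.+ b Nat.* c ≡ d Nat.* e → + a + + b * + c ≡ + d * + e
    cast-Bézout a b c d e eq = trans (sym (pos-affine a b c)) (trans (cong +_ eq) (ℤP.pos-* d e))

    inverse-ℕ : ∀ n → Unit (+ n) → Σ ℤ λ v → + n * v ≡ + 1 ⟨mod + p ⟩
    inverse-ℕ n unit-n with coprime-Bézout (coprime unit-n)
    ... | GCD.Bézout.+- x y eq = - + y , congruent (divides (- + x) (begin
          + n * - + y - + 1   ≡⟨ identity (+ n) (+ y) ⟩
          - (+ 1 + + y * + n) ≡⟨ cong -_ (cast-Bézout 1 y n x p eq) ⟩
          - (+ x * + p)       ≡⟨ ℤP.neg-distribˡ-* (+ x) (+ p) ⟩
          - + x * + p         ∎))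
      where
      open ≡-Reasoning
      identity : ∀ n y → n * - y - + 1 ≡ - (+ 1 + y * n)
      identity = solve-∀
    ... | GCD.Bézout.-+ x y eq = + y , congruent (divides (+ x) (begin
          + n * + y - + 1           ≡⟨ identity₁ (+ n) (+ y) ⟩
          + y * + n - + 1           ≡⟨ cong (_- + 1) (sym (cast-Bézout 1 x p y n eq)) ⟩
          (+ 1 + + x * + p) - + 1   ≡⟨ identity₂ (+ x) (+ p) ⟩
          + x * + p                 ∎))
      where
      open ≡-Reasoning
      identity₁ : ∀ n y → n * y - + 1 ≡ y * n - + 1
      identity₁ = solve-∀
      identity₂ : ∀ x p → (+ 1 + x * p) - + 1 ≡ x * p
      identity₂ = solve-∀

  inverse : ∀ w → Unit w → Σ ℤ λ v → w * v ≡ + 1 ⟨mod + p ⟩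
  inverse (+ n)     unit-w = inverse-ℕ n unit-w
  inverse -[1+ n ] unit-w with inverse-ℕ (suc n) (unit-neg unit-w)
  ... | v , nv≡1 = - v , subst (_≡ + 1 ⟨mod + p ⟩) (identity (+ suc n) v) nv≡1
    where identity : ∀ n v → n * v ≡ (- n) * (- v)
          identity = solve-∀

  inverse-unit : ∀ {w v} → w * v ≡ + 1 ⟨mod + p ⟩ → Unit v
  inverse-unit {w} {v} wv≡1 p∣v = unit-one (∣-resp-mod (mod-sym wv≡1) (∣n⇒∣m*n w p∣v))

  -- U₂/U₁ is, modulo p, the cube of a quotient of units: N³U₁ ≡ U₂w³.
  CubeRatio : ℤ → ℤ → Set
  CubeRatio U₁ U₂ = Σ ℤ λ N → Σ ℤ λ w → Unit N × Unit w × N * N * N * U₁ ≡ U₂ * (w * w * w) ⟨mod + p ⟩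

  -- Dividing by w: U₂/U₁ is the cube of the unit t = N/w.
  cubeRatio⇒cube : ∀ {U₁ U₂} → CubeRatio U₁ U₂ → Σ ℤ λ t → Unit t × t * t * t * U₁ ≡ U₂ ⟨mod + p ⟩
  cubeRatio⇒cube {U₁} {U₂} (N , w , unit-N , unit-w , congruent ratio) with inverse w unit-w
  ... | v , wv≡1 =
    N * v , unit-* unit-N (inverse-unit {w} wv≡1) ,
    congruent (∣-by₂ (v * v * v) (U₂ * ((w * v) * (w * v) + w * v + + 1)) (identity U₁ U₂ N w v) ratio (difference wv≡1))
    where identity : ∀ U₁ U₂ N w v →
            N * v * (N * v) * (N * v) * U₁ - U₂
              ≡ v * v * v * (N * N * N * U₁ - U₂ * (w * w * w)) + U₂ * ((w * v) * (w * v) + w * v + + 1) * (w * v - + 1)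
          identity = solve-∀

  Primitive : ℤ → ℤ → ℤ → Set
  Primitive x y z = ¬ (+ p ∣ x × + p ∣ y × + p ∣ z)

  third-coordinate : ∀ U₁ U₂ U₃ C x y z → Unit U₃ → + p ∣ cubic U₁ U₂ U₃ C x y z →
                     + p ∣ x → + p ∣ y → + p ∣ z
  third-coordinate U₁ U₂ U₃ C x y z unit-U₃ onCubic p∣x p∣y =
    unit-cube-∣ unit-U₃ (∣-by₃ (+ 1) (C * y * z - U₁ * x * x) (- (U₂ * y * y))
                                (identity U₁ U₂ U₃ C x y z) onCubic p∣x p∣y)
    where identity : ∀ U₁ U₂ U₃ C x y z → U₃ * (z * z * z)
                       ≡ + 1 * (U₁ * (x * x * x) + U₂ * (y * y * y) + U₃ * (z * z * z) - C * x * y * z)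
                         + (C * y * z - U₁ * x * x) * x + (- (U₂ * y * y)) * y
          identity = solve-∀

  cubeRatio-unscale : ∀ {a b x y} → Unit x → Unit y → CubeRatio (a * (x * x * x)) (b * (y * y * y)) → CubeRatio a b
  cubeRatio-unscale {a} {b} {x} {y} unit-x unit-y (α , β , unit-α , unit-β , congruent ratio) =
    x * α , y * β , unit-* unit-x unit-α , unit-* unit-y unit-β ,
    congruent (subst (+ p ∣_) (identity a b x y α β) ratio)
    where identity : ∀ a b x y α β →
            α * α * α * (a * (x * x * x)) - b * (y * y * y) * (β * β * β)
              ≡ x * α * (x * α) * (x * α) * a - b * (y * β * (y * β) * (y * β))
          identity = solve-∀

  descent : ∀ V U₁ U₂ U₃ C x y z → ¬ (p^ V ∣ x × p^ V ∣ y × p^ V ∣ z) →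
            p^ V * p^ V * p^ V * + p ∣ cubic U₁ U₂ U₃ C x y z →
            Σ ℤ λ x′ → Σ ℤ λ y′ → Σ ℤ λ z′ → Primitive x′ y′ z′ × + p ∣ cubic U₁ U₂ U₃ C x′ y′ z′
  descent zero U₁ U₂ U₃ C x y z notAll _ = ⊥-elim (notAll (1∣ x , 1∣ y , 1∣ z))
  descent (suc V) U₁ U₂ U₃ C x y z notAll onCubic with (+ p ∣? x) ×-dec (+ p ∣? y) ×-dec (+ p ∣? z)
  ... | no prim = x , y , z , prim , ∣-trans (∣n⇒∣m*n (p^ (suc V) * p^ (suc V) * p^ (suc V)) ∣-refl) onCubic
  ... | yes (divides x₁ refl , divides y₁ refl , divides z₁ refl) =
        descent V U₁ U₂ U₃ C x₁ y₁ z₁ (λ (d₁ , d₂ , d₃) → notAll (scale d₁ , scale d₂ , scale d₃))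
          (cancel-p³ (subst₂ _∣_ (modulus V) (cubic-homogeneous U₁ U₂ U₃ C x₁ y₁ z₁ (+ p)) onCubic))
    where
    scale : ∀ {a} → p^ V ∣ a → p^ (suc V) ∣ a * + p
    scale {a} d = subst (_∣ a * + p) (trans (ℤP.*-comm (p^ V) (+ p)) (sym (p^-suc V))) (*-monoˡ-∣ (+ p) d)
    cancel-p³ : ∀ {m a} → + p * (+ p * (+ p * m)) ∣ + p * (+ p * (+ p * a)) → m ∣ a
    cancel-p³ d = *-cancelˡ-∣ (+ p) (*-cancelˡ-∣ (+ p) (*-cancelˡ-∣ (+ p) d))
    modulus : ∀ V → p^ (suc V) * p^ (suc V) * p^ (suc V) * + p ≡ + p * (+ p * (+ p * (p^ V * p^ V * p^ V * + p)))
    modulus V = trans (cong (λ P → P * P * P * + p) (p^-suc V)) (identity (+ p) (p^ V))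
      where identity : ∀ p P → p * P * (p * P) * (p * P) * p ≡ p * (p * (p * (P * P * P * p)))
            identity = solve-∀

  -- Hensel's lemma for a·y³ + b: a zero y modulo μ (where p ∣ μ) at which the derivative 3ay²
  -- is a unit lifts to the zero y′ = y − (ay³ + b)/(3ay²) modulo pμ, congruent to y modulo μ.
  hensel-step : ∀ μ a b y → + p ∣ μ → Unit (+ 3 * a * (y * y)) → μ ∣ a * (y * y * y) + b →
                Σ ℤ λ y′ → + p * μ ∣ a * (y′ * y′ * y′) + b × y′ ≡ y ⟨mod μ ⟩
  hensel-step μ a b y (divides k μ≡kp) unit-D (divides q root≡qμ) = newton (inverse (+ 3 * a * (y * y)) unit-D)
    where
    newton : (Σ ℤ λ D′ → + 3 * a * (y * y) * D′ ≡ + 1 ⟨mod + p ⟩) →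
             Σ ℤ λ y′ → + p * μ ∣ a * (y′ * y′ * y′) + b × y′ ≡ y ⟨mod μ ⟩
    newton (D′ , congruent (divides r DD′≡1)) =
      y + (- q * D′) * μ ,
      ∣-by₃ (+ 1) (- q) (a * (+ 3 * y * (- q * D′) * (- q * D′) + (- q * D′) * (- q * D′) * (- q * D′) * μ))
            (expansion a b y q D′ μ) onRoot onDerivative onSquare ,
      congruent (divides (- q * D′) (step y (- q * D′) μ))
      where
      expansion : ∀ a b y q D′ μ → let δ = - q * D′ ; y′ = y + δ * μ in
        a * (y′ * y′ * y′) + b
          ≡ + 1 * (a * (y * y * y) + b - q * μ) + (- q) * (μ * (+ 3 * a * (y * y) * D′ - + 1))
            + (a * (+ 3 * y * δ * δ + δ * δ * δ * μ)) * (μ * μ)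
      expansion = solve-∀
      step : ∀ y δ μ → y + δ * μ - y ≡ δ * μ
      step = solve-∀
      onRoot : + p * μ ∣ a * (y * y * y) + b - q * μ
      onRoot = subst (_ ∣_) (sym (ℤP.i≡j⇒i-j≡0 root≡qμ)) ∣-zero
      onDerivative : + p * μ ∣ μ * (+ 3 * a * (y * y) * D′ - + 1)
      onDerivative = divides r (trans (cong (μ *_) DD′≡1) (reassoc μ r (+ p)))
        where reassoc : ∀ μ r p → μ * (r * p) ≡ r * (p * μ)
              reassoc = solve-∀
      onSquare : + p * μ ∣ μ * μ
      onSquare = divides k (trans (cong (_* μ) μ≡kp) (ℤP.*-assoc k (+ p) μ))

-- The residual curve modulo p; from here on 3 is invertible modulo p.
module Residual (p : ℕ) (p-prime : Prime p) (p≢3 : p ≢ 3) where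
  open ModPrime p p-prime

  unit-3 : Unit (+ 3)
  unit-3 p∣3 with prime⇒irreducible (from-yes (prime? 3)) (∣⇒∣ᵤ p∣3)
  ... | inj₁ refl = ¬prime[1] p-prime
  ... | inj₂ p≡3  = p≢3 p≡3

  unit-27 : Unit (+ 27)
  unit-27 = unit-cube unit-3

  equal⇒ratio : ∀ {A B} → + p ∣ A - B → CubeRatio A B
  equal⇒ratio {A} {B} p∣A-B = + 1 , + 1 , unit-one , unit-one , congruent (subst (+ p ∣_) (identity A B) p∣A-B)
    where identity : ∀ A B → A - B ≡ + 1 * + 1 * + 1 * A - B * (+ 1 * + 1 * + 1)
          identity = solve-∀

  cube-transfer : ∀ s G A B C → + p ∣ s - G → + p ∣ G * G * G - + 27 * A * B * C →
                  + p ∣ s * s * s - + 27 * A * B * C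
  cube-transfer s G A B C = ∣-by₂ (s * s + s * G + G * G) (+ 1) (identity s G A B C)
    where identity : ∀ s G A B C → s * s * s - + 27 * A * B * C
            ≡ (s * s + s * G + G * G) * (s - G) + + 1 * (G * G * G - + 27 * A * B * C)
          identity = solve-∀

  -- If A, B are units and the sum s = A + B + C satisfies s³ ≡ 27ABC modulo p, then A/B is a
  -- cube modulo p.  If s ≡ 3A or s ≡ 3B this forces A ≡ B; otherwise the identity
  --   (s − 3B)³·A − (s − 3A)³·B = (A − B)(s³ − 27ABC)
  -- exhibits B/A as the cube of (s − 3B)/(s − 3A).
  sumCube-ratio : ∀ A B C → Unit A → Unit B →
    + p ∣ (A + B + C) * (A + B + C) * (A + B + C) - + 27 * A * B * C → CubeRatio A B
  sumCube-ratio A B C unit-A unit-B cubeRelation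
    with + p ∣? (A + B + C - + 3 * A) | + p ∣? (A + B + C - + 3 * B)
  ... | yes p∣s-3A | _ = equal⇒ratio (unit-square-∣ (unit-* unit-27 unit-A)
        (∣-by₂ (+ 1) (- (+ 27 * A * A + + 9 * A * (s - + 3 * A) + (s - + 3 * A) * (s - + 3 * A) - + 27 * A * B))
               (identity A B C) cubeRelation p∣s-3A))
    where
    s = A + B + C
    identity : ∀ A B C → + 27 * A * ((A - B) * (A - B))
      ≡ + 1 * ((A + B + C) * (A + B + C) * (A + B + C) - + 27 * A * B * C)
        + (- (+ 27 * A * A + + 9 * A * (A + B + C - + 3 * A) + (A + B + C - + 3 * A) * (A + B + C - + 3 * A) - + 27 * A * B))
          * (A + B + C - + 3 * A)
    identity = solve-∀
  ... | no _ | yes p∣s-3B = equal⇒ratio (unit-square-∣ (unit-* unit-27 unit-B)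
        (∣-by₂ (+ 1) (- (+ 27 * B * B + + 9 * B * (s - + 3 * B) + (s - + 3 * B) * (s - + 3 * B) - + 27 * A * B))
               (identity A B C) cubeRelation p∣s-3B))
    where
    s = A + B + C
    identity : ∀ A B C → + 27 * B * ((A - B) * (A - B))
      ≡ + 1 * ((A + B + C) * (A + B + C) * (A + B + C) - + 27 * A * B * C)
        + (- (+ 27 * B * B + + 9 * B * (A + B + C - + 3 * B) + (A + B + C - + 3 * B) * (A + B + C - + 3 * B) - + 27 * A * B))
          * (A + B + C - + 3 * B)
    identity = solve-∀
  ... | no unit-s-3A | no unit-s-3B =
    A + B + C - + 3 * B , A + B + C - + 3 * A , unit-s-3B , unit-s-3A ,
    congruent (∣-by₁ (A - B) (identity A B C) cubeRelation)
    where
    identity : ∀ A B C →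
      (A + B + C - + 3 * B) * (A + B + C - + 3 * B) * (A + B + C - + 3 * B) * A
        - B * ((A + B + C - + 3 * A) * (A + B + C - + 3 * A) * (A + B + C - + 3 * A))
      ≡ (A - B) * ((A + B + C) * (A + B + C) * (A + B + C) - + 27 * A * B * C)
    identity = solve-∀

  module _ {u₁ u₂ u₃ c : ℤ} (unit-u₁ : Unit u₁) (unit-u₂ : Unit u₂) (unit-u₃ : Unit u₃)
           (singular : c * c * c ≡ + 27 * u₁ * u₂ * u₃ ⟨mod + p ⟩) where

    unit-c : Unit c
    unit-c p∣c = unit-* (unit-* (unit-* unit-27 unit-u₁) unit-u₂) unit-u₃
      (∣-resp-mod (mod-sym singular) (∣n⇒∣m*n (c * c) p∣c))

    -- On a zero of the cubic mod p, the terms A = u₁x³, B = u₂y³, C = u₃z³ have sum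
    -- s ≡ cxyz, hence s³ ≡ (cxyz)³ ≡ 27ABC.
    sumCube-onCubic : ∀ {x y z} → + p ∣ cubic u₁ u₂ u₃ c x y z →
      + p ∣ (u₁ * (x * x * x) + u₂ * (y * y * y) + u₃ * (z * z * z))
            * (u₁ * (x * x * x) + u₂ * (y * y * y) + u₃ * (z * z * z))
            * (u₁ * (x * x * x) + u₂ * (y * y * y) + u₃ * (z * z * z))
            - + 27 * (u₁ * (x * x * x)) * (u₂ * (y * y * y)) * (u₃ * (z * z * z))
    sumCube-onCubic {x} {y} {z} onCubic =
      cube-transfer (u₁ * (x * x * x) + u₂ * (y * y * y) + u₃ * (z * z * z)) (c * x * y * z)
                    (u₁ * (x * x * x)) (u₂ * (y * y * y)) (u₃ * (z * z * z))
                    onCubic (∣-by₁ (x * y * z * (x * y * z) * (x * y * z)) (scaledSingular u₁ u₂ u₃ c x y z) (difference singular))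
      where
      scaledSingular : ∀ u₁ u₂ u₃ c x y z →
        (c * x * y * z) * (c * x * y * z) * (c * x * y * z) - + 27 * (u₁ * (x * x * x)) * (u₂ * (y * y * y)) * (u₃ * (z * z * z))
          ≡ (x * y * z * (x * y * z) * (x * y * z)) * (c * c * c - + 27 * u₁ * u₂ * u₃)
      scaledSingular = solve-∀

    ratio-xy : ∀ {x y z} → Unit x → Unit y → + p ∣ cubic u₁ u₂ u₃ c x y z → CubeRatio u₁ u₂
    ratio-xy {x} {y} {z} unit-x unit-y onCubic =
      cubeRatio-unscale {u₁} {u₂} {x} {y} unit-x unit-y
        (sumCube-ratio (u₁ * (x * x * x)) (u₂ * (y * y * y)) (u₃ * (z * z * z))
          (unit-* unit-u₁ (unit-cube unit-x)) (unit-* unit-u₂ (unit-cube unit-y)) (sumCube-onCubic onCubic))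

    ratio-y≡0 : ∀ {x y z} → Unit x → Unit z → + p ∣ y → + p ∣ cubic u₁ u₂ u₃ c x y z → CubeRatio u₁ u₂
    ratio-y≡0 {x} {y} {z} unit-x unit-z p∣y onCubic =
      - c * z , + 3 * u₁ * x , unit-* (unit-neg unit-c) unit-z , unit-* (unit-* unit-3 unit-u₁) unit-x ,
      congruent (∣-by₃ (- (z * z * z * u₁)) (- (+ 27 * u₁ * u₁ * u₂)) (+ 27 * u₁ * u₁ * u₂ * (u₂ * y * y - c * x * z))
                       (identity u₁ u₂ u₃ c x y z) (difference singular) onCubic p∣y)
      where identity : ∀ u₁ u₂ u₃ c x y z →
              (- c * z) * (- c * z) * (- c * z) * u₁ - u₂ * ((+ 3 * u₁ * x) * (+ 3 * u₁ * x) * (+ 3 * u₁ * x))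
                ≡ (- (z * z * z * u₁)) * (c * c * c - + 27 * u₁ * u₂ * u₃)
                  + (- (+ 27 * u₁ * u₁ * u₂)) * (u₁ * (x * x * x) + u₂ * (y * y * y) + u₃ * (z * z * z) - c * x * y * z)
                  + (+ 27 * u₁ * u₁ * u₂ * (u₂ * y * y - c * x * z)) * y
            identity = solve-∀

    ratio-x≡0 : ∀ {x y z} → Unit y → Unit z → + p ∣ x → + p ∣ cubic u₁ u₂ u₃ c x y z → CubeRatio u₁ u₂
    ratio-x≡0 {x} {y} {z} unit-y unit-z p∣x onCubic =
      - + 3 * u₂ * y , c * z , unit-* (unit-* (unit-neg unit-3) unit-u₂) unit-y , unit-* unit-c unit-z ,
      congruent (∣-by₃ (- (u₂ * (z * z * z))) (- (+ 27 * u₁ * u₂ * u₂)) (+ 27 * u₁ * u₂ * u₂ * (u₁ * x * x - c * y * z))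
                       (identity u₁ u₂ u₃ c x y z) (difference singular) onCubic p∣x)
      where identity : ∀ u₁ u₂ u₃ c x y z →
              (- + 3 * u₂ * y) * (- + 3 * u₂ * y) * (- + 3 * u₂ * y) * u₁ - u₂ * ((c * z) * (c * z) * (c * z))
                ≡ (- (u₂ * (z * z * z))) * (c * c * c - + 27 * u₁ * u₂ * u₃)
                  + (- (+ 27 * u₁ * u₂ * u₂)) * (u₁ * (x * x * x) + u₂ * (y * y * y) + u₃ * (z * z * z) - c * x * y * z)
                  + (+ 27 * u₁ * u₂ * u₂ * (u₁ * x * x - c * y * z)) * x
            identity = solve-∀

    residual-ratio : ∀ {x y z} → Primitive x y z → + p ∣ cubic u₁ u₂ u₃ c x y z → CubeRatio u₁ u₂
    residual-ratio {x} {y} {z} prim onCubic with + p ∣? x | + p ∣? y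
    ... | no unit-x | no unit-y = ratio-xy unit-x unit-y onCubic
    ... | _         | yes p∣y   = ratio-y≡0 unit-x unit-z p∣y onCubic
      where
      unit-x : Unit x
      unit-x p∣x = prim (p∣x , p∣y , third-coordinate u₁ u₂ u₃ c x y z unit-u₃ onCubic p∣x p∣y)
      unit-z : Unit z
      unit-z p∣z = prim (third-coordinate u₂ u₃ u₁ c y z x unit-u₁
                            (subst (+ p ∣_) (cubic-rotate u₁ u₂ u₃ c x y z) onCubic) p∣y p∣z , p∣y , p∣z)
    ... | yes p∣x   | no unit-y = ratio-x≡0 unit-y unit-z p∣x onCubic
      where
      unit-z : Unit z
      unit-z p∣z = unit-y (third-coordinate u₃ u₁ u₂ c z x y unit-u₂ (subst (+ p ∣_) (cubic-rotate u₂ u₃ u₁ c y z x)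
                     (subst (+ p ∣_) (cubic-rotate u₁ u₂ u₃ c x y z) onCubic)) p∣z p∣x)

-- The hypotheses and the conclusion of the theorem only involve the level-1 residues of
-- u₁, u₂, u₃, c; here they are translated to statements about integers modulo p.
module LevelOne (p : ℕ) (p-prime : Prime p) (u₁ u₂ u₃ c : ℤₚ p) where
  open ModPrime p p-prime

  U₁ U₂ U₃ C : ℤ
  U₁ = + res u₁ 1
  U₂ = + res u₂ 1
  U₃ = + res u₃ 1
  C  = + res c 1

  units : ¬ vₚprod≥ u₁ u₂ u₃ 1 → Unit U₁ × Unit U₂ × Unit U₃
  units valuation0 =
    (λ p∣U₁ → unit-product (∣m⇒∣m*n U₃ (∣m⇒∣m*n U₂ p∣U₁))) ,
    (λ p∣U₂ → unit-product (∣m⇒∣m*n U₃ (∣n⇒∣m*n U₁ p∣U₂))) ,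
    (λ p∣U₃ → unit-product (∣n⇒∣m*n (U₁ * U₂) p∣U₃))
    where
    unit-product : Unit (U₁ * U₂ * U₃)
    unit-product p∣ =
      valuation0 (∣⇒mod (∣⇒≡0 (subst₂ _∣_ (sym p^-1) (sym (pos-*₃ (res u₁ 1) (res u₂ 1) (res u₃ 1))) p∣)))

  singular : vₚdisc>0 u₁ u₂ u₃ c → C * C * C ≡ + 27 * U₁ * U₂ * U₃ ⟨mod + p ⟩
  singular disc = mod-sym (mod-cast cast-27 (pos-cube (res c 1)) p^-1 (mod⇒∣ disc))
    where
    cast-27 : + (27 Nat.* (res u₁ 1 Nat.* res u₂ 1 Nat.* res u₃ 1)) ≡ + 27 * U₁ * U₂ * U₃
    cast-27 = trans (ℤP.pos-* 27 (res u₁ 1 Nat.* res u₂ 1 Nat.* res u₃ 1))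
                    (trans (cong (+ 27 *_) (pos-*₃ (res u₁ 1) (res u₂ 1) (res u₃ 1))) (assoc (+ 27) U₁ U₂ U₃))
      where assoc : ∀ k a b c → k * (a * b * c) ≡ k * a * b * c
            assoc = solve-∀

  cast-cube : ∀ t a → + (t Nat.^ 3 Nat.* a) ≡ + t * + t * + t * + a
  cast-cube t a = trans (ℤP.pos-* (t Nat.^ 3) a) (cong (_* + a) (pos-cube t))

  cube⇒ratioIsCube : (Σ ℤ λ t → Unit t × t * t * t * U₁ ≡ U₂ ⟨mod + p ⟩) → ratioIsCubeModp u₂ u₁
  cube⇒ratioIsCube (t , unit-t , t³U₁≡U₂) with reduce p t
  ... | r , _ , r≡t =
    r , (λ r≡0 → unit-t (≡0⇒∣ (mod-trans (mod-sym r≡t) (mod⇒∣ r≡0)))) ,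
    ∣⇒mod (mod-cast (sym (cast-cube r (res u₁ 1))) refl refl (mod-trans (mod-*ʳ U₁ (cube-mod r≡t)) t³U₁≡U₂))

  ratioIsCube⇒cube : ratioIsCubeModp u₂ u₁ → Σ ℤ λ t → Unit t × t * t * t * U₁ ≡ U₂ ⟨mod + p ⟩
  ratioIsCube⇒cube (t , t≢0 , t³U₁≡U₂) =
    + t , (λ p∣t → t≢0 (∣⇒mod (∣⇒≡0 p∣t))) , mod-cast (cast-cube t (res u₁ 1)) refl refl (mod⇒∣ t³U₁≡U₂)

module Forward (p : ℕ) (p-prime : Prime p) (p≢3 : p ≢ 3) (u₁ u₂ u₃ c : ℤₚ p)
               (valuation0 : ¬ vₚprod≥ u₁ u₂ u₃ 1) (disc : vₚdisc>0 u₁ u₂ u₃ c) where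
  open ModPrime p p-prime
  open Residual p p-prime p≢3
  open LevelOne p p-prime u₁ u₂ u₃ c

  unit-U₁ : Unit U₁
  unit-U₁ = proj₁ (units valuation0)
  unit-U₂ : Unit U₂
  unit-U₂ = proj₁ (proj₂ (units valuation0))
  unit-U₃ : Unit U₃
  unit-U₃ = proj₂ (proj₂ (units valuation0))

  -- At level 3V + 1 the modulus is (p^V)³·p, as required by the descent.
  level : ℕ → ℕ
  level V = V Nat.+ V Nat.+ V Nat.+ 1

  p^-level : ∀ V → p^ (level V) ≡ p^ V * p^ V * p^ V * + p
  p^-level V = trans (p^-+ (V Nat.+ V Nat.+ V) 1) (cong₂ _*_ (p^-sum₃ V V V) p^-1)

  below-level : ∀ k₀ s → k₀ Nat.≤ level (k₀ Nat.+ s)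
  below-level k₀ s = ℕP.≤-trans (ℕP.m≤m+n k₀ s) (V≤level (k₀ Nat.+ s))
    where
    V≤level : ∀ V → V Nat.≤ level V
    V≤level V = ℕP.≤-trans (ℕP.m≤m+n V V)
                  (ℕP.≤-trans (ℕP.m≤m+n (V Nat.+ V) V) (ℕP.m≤m+n (V Nat.+ V Nat.+ V) 1))

  NotAllDivisible : ℚₚ p → ℚₚ p → ℚₚ p → ℕ → Set
  NotAllDivisible X Y Z V =
    ¬ (p^ V ∣ + res (num X) (level V) * p^ (exp Y Nat.+ exp Z)
     × p^ V ∣ + res (num Y) (level V) * p^ (exp X Nat.+ exp Z)
     × p^ V ∣ + res (num Z) (level V) * p^ (exp X Nat.+ exp Y))

  not-all-divisible : ∀ X Y Z → NonzeroQₚ X ⊎ NonzeroQₚ Y ⊎ NonzeroQₚ Z → Σ ℕ (NotAllDivisible X Y Z)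
  not-all-divisible X Y Z (inj₁ (k₀ , nonzero)) = k₀ Nat.+ s ,
    λ (d , _ , _) → nonzero-persists (num X) s nonzero (below-level k₀ s) d
    where s = exp Y Nat.+ exp Z
  not-all-divisible X Y Z (inj₂ (inj₁ (k₀ , nonzero))) = k₀ Nat.+ s ,
    λ (_ , d , _) → nonzero-persists (num Y) s nonzero (below-level k₀ s) d
    where s = exp X Nat.+ exp Z
  not-all-divisible X Y Z (inj₂ (inj₂ (k₀ , nonzero))) = k₀ Nat.+ s ,
    λ (_ , _ , d) → nonzero-persists (num Z) s nonzero (below-level k₀ s) d
    where s = exp X Nat.+ exp Y

  primitive⇒ratio : ∀ K → 1 Nat.≤ K → (Σ ℤ λ x → Σ ℤ λ y → Σ ℤ λ z → Primitive x y z ×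
                      + p ∣ cubic (+ res u₁ K) (+ res u₂ K) (+ res u₃ K) (+ res c K) x y z) → CubeRatio U₁ U₂
  primitive⇒ratio K 1≤K (x , y , z , prim , onCubicK) =
    residual-ratio {U₁} {U₂} {U₃} {C} unit-U₁ unit-U₂ unit-U₃ (singular disc) {x} {y} {z} prim
      (∣-resp-mod (cubic-coefficients U₁ U₂ U₃ C (+ res u₁ K) (+ res u₂ K) (+ res u₃ K) (+ res c K) x y z
                     (mod-sym (level-one u₁ 1≤K)) (mod-sym (level-one u₂ 1≤K))
                     (mod-sym (level-one u₃ 1≤K)) (mod-sym (level-one c 1≤K)))
                  onCubicK)

  forward : HasNontrivialQₚPoint u₁ u₂ u₃ c → ratioIsCubeModp u₂ u₁
  forward (X , Y , Z , nonzero , onCubic) = atLevel (not-all-divisible X Y Z nonzero)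
    where
    atLevel : Σ ℕ (NotAllDivisible X Y Z) → ratioIsCubeModp u₂ u₁
    atLevel (V , notAll) = cube⇒ratioIsCube (cubeRatio⇒cube (primitive⇒ratio (level V) (ℕP.m≤n+m 1 _)
      (descent V (+ res u₁ K) (+ res u₂ K) (+ res u₃ K) (+ res c K)
        (+ res (num X) K * p^ (exp Y Nat.+ exp Z)) (+ res (num Y) K * p^ (exp X Nat.+ exp Z))
        (+ res (num Z) K * p^ (exp X Nat.+ exp Y))
        notAll (subst (_∣ levelCubic u₁ u₂ u₃ c X Y Z K) (p^-level V) (cubicZero⇒level u₁ u₂ u₃ c X Y Z onCubic K)))))
      where K = level V

module Backward (p : ℕ) (p-prime : Prime p) (p≢3 : p ≢ 3) (u₁ u₂ u₃ c : ℤₚ p)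
                (valuation0 : ¬ vₚprod≥ u₁ u₂ u₃ 1) where
  open ModPrime p p-prime
  open Residual p p-prime p≢3
  open LevelOne p p-prime u₁ u₂ u₃ c

  Root : ℕ → ℤ → Set
  Root k y = p^ k ∣ + res u₂ k * (y * y * y) + + res u₁ k

  root-mod : ∀ {k a b} → a ≡ b ⟨mod p^ k ⟩ → Root k b → Root k a
  root-mod {k} {a} {b} a≡b root =
    ∣-by₂ (+ 1) (+ res u₂ k) (identity (+ res u₁ k) (+ res u₂ k) a b) root (difference (cube-mod a≡b))
    where identity : ∀ U₁ U₂ a b → U₂ * (a * a * a) + U₁ ≡ + 1 * (U₂ * (b * b * b) + U₁) + U₂ * (a * a * a - b * b * b)
          identity = solve-∀

  unit-u₂ : ∀ k → Unit (+ res u₂ (suc k))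
  unit-u₂ k p∣u₂ = proj₁ (proj₂ (units valuation0)) (∣-resp-mod (mod-sym (level-one u₂ (s≤s z≤n))) p∣u₂)

  -- One Hensel step, after replacing the coefficients by their residues one level up.
  root-step : ∀ n y → Root (suc n) y → Unit y →
              Σ ℤ λ y′ → (Root (suc (suc n)) y′ × Unit y′) × y′ ≡ y ⟨mod p^ (suc n) ⟩
  root-step n y root unit-y = lifted (hensel-step (p^ (suc n)) U₂′ U₁′ y p∣p^ unit-derivative root′)
    where
    U₁′ = + res u₁ (suc (suc n))
    U₂′ = + res u₂ (suc (suc n))
    root′ : p^ (suc n) ∣ U₂′ * (y * y * y) + U₁′
    root′ = ∣-by₃ (+ 1) (y * y * y) (+ 1) (identity (+ res u₁ (suc n)) (+ res u₂ (suc n)) U₁′ U₂′ y) root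
              (difference (res-mod u₂ (ℕP.n≤1+n (suc n)))) (difference (res-mod u₁ (ℕP.n≤1+n (suc n))))
      where identity : ∀ U₁ U₂ U₁′ U₂′ y → U₂′ * (y * y * y) + U₁′
              ≡ + 1 * (U₂ * (y * y * y) + U₁) + (y * y * y) * (U₂′ - U₂) + + 1 * (U₁′ - U₁)
            identity = solve-∀
    p∣p^ : + p ∣ p^ (suc n)
    p∣p^ = divides (p^ n) (trans (p^-suc n) (ℤP.*-comm (+ p) (p^ n)))
    unit-derivative : Unit (+ 3 * U₂′ * (y * y))
    unit-derivative = unit-* (unit-* unit-3 (unit-u₂ (suc n))) (unit-* unit-y unit-y)
    lifted : (Σ ℤ λ y′ → + p * p^ (suc n) ∣ U₂′ * (y′ * y′ * y′) + U₁′ × y′ ≡ y ⟨mod p^ (suc n) ⟩) →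
             Σ ℤ λ y′ → (Root (suc (suc n)) y′ × Unit y′) × y′ ≡ y ⟨mod p^ (suc n) ⟩
    lifted (y′ , root″ , y′≡y) =
      y′ , (subst (_∣ U₂′ * (y′ * y′ * y′) + U₁′) (sym (p^-suc (suc n))) root″ ,
            λ p∣y′ → unit-y (∣-resp-mod (mod-sym (mod-weaken p∣p^ y′≡y)) p∣y′)) , y′≡y

  module Lift (y₀ : ℤ) (root₀ : Root 1 y₀) (unit₀ : Unit y₀) where
    mutual
      approximation : ∀ n → Σ ℤ λ y → Root (suc n) y × Unit y
      approximation zero    = y₀ , root₀ , unit₀
      approximation (suc n) = proj₁ (next n) , proj₁ (proj₂ (next n))

      next : ∀ n → Σ ℤ λ y′ → (Root (suc (suc n)) y′ × Unit y′)
                              × y′ ≡ proj₁ (approximation n) ⟨mod p^ (suc n) ⟩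
      next n = root-step n (proj₁ (approximation n)) (proj₁ (proj₂ (approximation n))) (proj₂ (proj₂ (approximation n)))

    sequence : ℕ → ℤ
    sequence zero    = + 0
    sequence (suc n) = proj₁ (approximation n)

    coherent : ∀ k → sequence (suc k) ≡ sequence k ⟨mod p^ k ⟩
    coherent zero    = congruent (1∣ (sequence 1 - sequence 0))
    coherent (suc n) = proj₂ (proj₂ (next n))

    Y : ℤₚ p
    Y = fromCoherent sequence coherent

    Y-root : ∀ n → Root (suc n) (+ res Y (suc n))
    Y-root n = root-mod (fromCoherent-res sequence coherent (suc n)) (proj₁ (proj₂ (approximation n)))

  one : ℤₚ p
  one = mkℤₚ residue below coherent
    where
    residue : ℕ → ℕ
    residue zero    = 0
    residue (suc _) = 1
    below : ∀ k → residue k Nat.< p Nat.^ k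
    below zero    = s≤s z≤n
    below (suc k) = ℕP.<-≤-trans (Nat.nonTrivial⇒n>1 p {{prime⇒nonTrivial p-prime}}) (ℕP.m≤m*n p (p Nat.^ k) {{ℕP.m^n≢0 p k}})
    coherent : ∀ k → residue (suc k) ≡ residue k [mod p Nat.^ k ]
    coherent zero    = ∣⇒mod (congruent (1∣ (+ 1 - + 0)))
    coherent (suc k) = 0 , 0 , refl

  zero′ : ℤₚ p
  zero′ = mkℤₚ (λ _ → 0) (ℕP.m^n>0 p) (λ _ → 0 , 0 , refl)

  initial-root : (Σ ℤ λ t → Unit t × t * t * t * U₁ ≡ U₂ ⟨mod + p ⟩) → Σ ℤ λ y₀ → Root 1 y₀ × Unit y₀
  initial-root (t , unit-t , congruent t³U₁≡U₂) with inverse t unit-t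
  ... | v , tv≡1 =
    - v , subst (_∣ U₂ * (- v * - v * - v) + U₁) (sym p^-1)
            (∣-by₂ (v * v * v) (- (U₁ * ((t * v) * (t * v) + t * v + + 1))) (identity U₁ U₂ t v) t³U₁≡U₂ (difference tv≡1)) ,
    unit-neg (inverse-unit {t} {v} tv≡1)
    where identity : ∀ U₁ U₂ t v → U₂ * (- v * - v * - v) + U₁
            ≡ (v * v * v) * (t * t * t * U₁ - U₂) + (- (U₁ * ((t * v) * (t * v) + t * v + + 1))) * (t * v - + 1)
          identity = solve-∀

  backward : ratioIsCubeModp u₂ u₁ → HasNontrivialQₚPoint u₁ u₂ u₃ c
  backward ratio = point (initial-root (ratioIsCube⇒cube ratio))
    where
    point : (Σ ℤ λ y₀ → Root 1 y₀ × Unit y₀) → HasNontrivialQₚPoint u₁ u₂ u₃ c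
    point (y₀ , root₀ , unit₀) =
      one /p^ 0 , Y /p^ 0 , zero′ /p^ 0 ,
      inj₁ (1 , λ 1≡0 → unit-one (≡0⇒∣ (mod-cast refl refl p^-1 (mod⇒∣ 1≡0)))) ,
      level⇒cubicZero u₁ u₂ u₃ c (one /p^ 0) (Y /p^ 0) (zero′ /p^ 0) onLevel
      where
      open Lift y₀ root₀ unit₀
      onLevel : ∀ k → p^ k ∣ levelCubic u₁ u₂ u₃ c (one /p^ 0) (Y /p^ 0) (zero′ /p^ 0) k
      onLevel zero    = 1∣ (levelCubic u₁ u₂ u₃ c (one /p^ 0) (Y /p^ 0) (zero′ /p^ 0) 0)
      onLevel (suc n) = subst (p^ (suc n) ∣_) (sym (cubic-at-1y0 (+ res u₁ (suc n)) (+ res u₂ (suc n)) (+ res u₃ (suc n)) (+ res c (suc n)) (+ res Y (suc n) * + 1)))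
                          (root-mod (mod-cast (sym (ℤP.*-identityʳ (+ res Y (suc n)))) refl refl mod-refl) (Y-root n))

lemma5p5 : (p : ℕ) → Prime p → p ≢ 3 →
    (u₁ u₂ u₃ c : ℤₚ p) →
    pReduced u₁ u₂ u₃ c →
    ¬ vₚprod≥ u₁ u₂ u₃ 1 →
    vₚdisc>0 u₁ u₂ u₃ c →
    (HasNontrivialQₚPoint u₁ u₂ u₃ c ⇔ ratioIsCubeModp u₂ u₁)
lemma5p5 p p-prime p≢3 u₁ u₂ u₃ c _ valuation0 disc =
  mk⇔ (Forward.forward p p-prime p≢3 u₁ u₂ u₃ c valuation0 disc)
      (Backward.backward p p-prime p≢3 u₁ u₂ u₃ c valuation0)
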